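{- Let $k\ge 1$. A graph $G$ is a $k$-probe complete graph if and only if $G$ is obtained from $G[k]$ by substituting the vertex $\emptyset$ by a (possibly empty) clique and every other vertex by a (possibly empty) independent set.
   Context: All graphs are finite, simple and undirected. For a graph $G=(V,E)$, the complete width $cow(G)$ is the minimum $k\ge 0$ such that there exist $k$ independent sets $N_1,\dots,N_k\subseteq V$ with the property that for every two distinct non-adjacent vertices $x,y$ of $G$ there is an $i$ with $x,y\in N_i$. A $k$-probe complete graph is a graph $G$ with $cow(G)\le k$. For $k\ge 1$, $G[k]$ is the graph whose vertices are all subsets of $\{1,\dots,k\}$, two distinct subsets $M,L$ being adjacent iff $M\cap L=\emptyset$; the vertex $\emptyset$ is universal in $G[k]$ (it is the unique universal vertex for $k\ge2$, and for $k=1$, where $G[1]=K_2$, it is the designated universal vertex). Substituting a vertex $v$ of a graph $G$ by a graph $H$ means taking $(G-v)$ together with a disjoint copy of $H$ and adding all edges between vertices of $N_G(v)$ and vertices of $H$ (substituting by the empty graph just deletes $v$). -}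

module Defs where

open import Data.Nat using (ℕ; zero; suc; _≤_)
open import Data.Fin using (Fin)
open import Data.Fin.Subset using (Subset; _∈_; _∩_) renaming (⊥ to ∅)
open import Data.Bool using (Bool; true; false; if_then_else_; _∧_)
open import Data.Vec using ([]; _∷_)
open import Data.Product using (Σ; ∃; _×_; _,_; proj₁; proj₂)
open import Data.Empty using (⊥)
open import Relation.Nullary using (¬_)
open import Relation.Binary using (Decidable)
open import Relation.Binary.PropositionalEquality using (_≡_; _≢_)
open import Function.Bundles using (_↔_; _⇔_; Inverse)

record Graph : Set₁ where
  field
    V : Set
    E : V → V → Set
open Graph public

FinGraph : ℕ → Set₁
FinGraph n = Fin n → Fin n → Set

toGraph : ∀ {n} → FinGraph n → Graph
toGraph {n} E = record { V = Fin n ; E = E }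

IsSimple : ∀ {n} → FinGraph n → Set
IsSimple E = (∀ x y → E x y → E y x) × (∀ x → ¬ E x x)

IsIndependent : ∀ {n} → FinGraph n → Subset n → Set
IsIndependent E N = ∀ x y → x ∈ N → y ∈ N → ¬ E x y

CompleteCover : ∀ {n} → FinGraph n → (k : ℕ) → Set
CompleteCover {n} E k =
  Σ (Fin k → Subset n) λ N →
    (∀ i → IsIndependent E (N i)) ×
    (∀ x y → x ≢ y → ¬ E x y → ∃ λ i → x ∈ N i × y ∈ N i)

-- cow(G) ≤ k  (cow is the minimum size of a complete cover)
cow≤ : ∀ {n} → FinGraph n → ℕ → Set
cow≤ E k = ∃ λ m → m ≤ k × CompleteCover E m

G[_] : ℕ → Graph
G[ k ] = record { V = Subset k ; E = λ M L → M ≢ L × (M ∩ L) ≡ ∅ }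

Clique : ℕ → Graph
Clique a = record { V = Fin a ; E = λ i j → i ≢ j }

Indep : ℕ → Graph
Indep a = record { V = Fin a ; E = λ _ _ → ⊥ }

data SubstE (G : Graph) (H : V G → Graph) : Σ (V G) (λ v → V (H v)) → Σ (V G) (λ v → V (H v)) → Set where
  inside : ∀ {v x y} → E (H v) x y → SubstE G H (v , x) (v , y)
  across : ∀ {v w x y} → E G v w → SubstE G H (v , x) (w , y)

Substitute : (G : Graph) → (H : V G → Graph) → Graph
Substitute G H = record { V = Σ (V G) (λ v → V (H v)) ; E = SubstE G H }

_≅_ : Graph → Graph → Set
G ≅ H = Σ (V G ↔ V H) λ f → ∀ x y → E G x y ⇔ E H (Inverse.to f x) (Inverse.to f y)

isEmptySet : ∀ {k} → Subset k → Bool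
isEmptySet [] = true
isEmptySet (b ∷ M) = if b then false else isEmptySet M

blob : ∀ {k} → (Subset k → ℕ) → Subset k → Graph
blob s M = if isEmptySet M then Clique (s M) else Indep (s M)

-- Transposing a family of k independent sets N₁ … N_k gives each vertex x the
-- label {i ∣ x ∈ Nᵢ} ⊆ {1 … k}.  For a complete cover, x and y are adjacent
-- exactly when they are distinct with disjoint labels, and conversely any
-- labelling with this property transposes back to a complete cover.  A graph
-- whose adjacency is "distinct with disjoint labels" is precisely G[k] with
-- every label class substituted in: the class of ∅ becomes a clique, every
-- other class (whose members share a label, hence are non-adjacent) an
-- independent set.

module Submission where

open import Defs
open import Data.Nat using (ℕ; zero; suc; _≤_; _≤′_; ≤′-refl; ≤′-step)
open import Data.Nat.Properties using (≤-refl; ≤⇒≤′)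
open import Data.Fin using (Fin; zero; suc)
open import Data.Fin.Subset using (Subset; _∈_; _∩_) renaming (⊥ to ∅)
open import Data.Fin.Subset.Properties using (∉⊥; Empty-unique; nonempty?; x∈p∩q⁺; x∈p∩q⁻; ∩-idem)
open import Data.Bool using (true; false)
import Data.Bool as Bool
open import Data.Vec using ([]; _∷_; lookup; tabulate)
open import Data.Vec.Properties using (≡-dec; lookup∘tabulate; []=⇒lookup; lookup⇒[]=)
open import Data.Product using (Σ; ∃; _×_; _,_; proj₁; proj₂)
open import Data.Product.Function.Dependent.Propositional using (Σ-↔)
open import Data.Empty using (⊥-elim)
open import Relation.Nullary using (¬_; yes; no)
open import Relation.Binary using (Decidable; DecidableEquality)
import Relation.Unary as U
open import Relation.Binary.PropositionalEquality using (_≡_; _≢_; refl; sym; trans; cong; subst)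
open import Function using (_∘_)
open import Function.Bundles using (_⇔_; _↔_; Inverse; Equivalence; mk↔ₛ′; mk⇔)
open import Function.Properties.Inverse using (↔-trans; ↔-refl)
open import Axiom.UniquenessOfIdentityProofs using (module Decidable⇒UIP)

_≟ˢ_ : ∀ {k} → DecidableEquality (Subset k)
_≟ˢ_ = ≡-dec Bool._≟_

isEmptySet⇔≡∅ : ∀ {k} (M : Subset k) → isEmptySet M ≡ true ⇔ M ≡ ∅
isEmptySet⇔≡∅ {k} M = mk⇔ (to M) from
  where
  to : ∀ {k} (M : Subset k) → isEmptySet M ≡ true → M ≡ ∅
  to []          _ = refl
  to (true ∷ M)  ()
  to (false ∷ M) e = cong (false ∷_) (to M e)
  isEmptySet-∅ : ∀ k → isEmptySet (∅ {k}) ≡ true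
  isEmptySet-∅ zero    = refl
  isEmptySet-∅ (suc k) = isEmptySet-∅ k
  from : M ≡ ∅ → isEmptySet M ≡ true
  from refl = isEmptySet-∅ k

self-disjoint⇒≡∅ : ∀ {k} {M : Subset k} → M ∩ M ≡ ∅ → M ≡ ∅
self-disjoint⇒≡∅ {M = M} = trans (sym (∩-idem M))

Represents : ∀ {k} (G : Graph) → (V G → Subset k) → Set
Represents G label = ∀ x y → E G x y ⇔ (x ≢ y × label x ∩ label y ≡ ∅)

transpose : ∀ {m n} → (Fin m → Subset n) → Fin n → Subset m
transpose N x = tabulate (λ i → lookup (N i) x)

∈-transpose⁺ : ∀ {m n} (N : Fin m → Subset n) {i x} → x ∈ N i → i ∈ transpose N x
∈-transpose⁺ N {i} {x} x∈Nᵢ =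
  lookup⇒[]= i _ (trans (lookup∘tabulate (λ j → lookup (N j) x) i) ([]=⇒lookup x∈Nᵢ))

∈-transpose⁻ : ∀ {m n} (N : Fin m → Subset n) {i x} → i ∈ transpose N x → x ∈ N i
∈-transpose⁻ N {i} {x} i∈Nˣ =
  lookup⇒[]= x (N i)
    (trans (sym (lookup∘tabulate (λ j → lookup (N j) x) i)) ([]=⇒lookup i∈Nˣ))

cover⇒represents : ∀ {n k} {E : FinGraph n} → IsSimple E → Decidable E →
                   ((N , _) : CompleteCover E k) → Represents (toGraph E) (transpose N)
cover⇒represents {E = E} (_ , irrefl) E? (N , independent , covers) x y =
  mk⇔ adjacent⇒ ⇒adjacent
  where
  adjacent⇒ : E x y → x ≢ y × transpose N x ∩ transpose N y ≡ ∅
  adjacent⇒ e = (λ { refl → irrefl x e }) , Empty-unique λ (i , i∈∩) →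
    let (i∈Nˣ , i∈Nʸ) = x∈p∩q⁻ _ _ i∈∩
    in independent i x y (∈-transpose⁻ N i∈Nˣ) (∈-transpose⁻ N i∈Nʸ) e
  ⇒adjacent : x ≢ y × transpose N x ∩ transpose N y ≡ ∅ → E x y
  ⇒adjacent (x≢y , disjoint) with E? x y
  ... | yes e  = e
  ... | no ¬e with covers x y x≢y ¬e
  ...   | i , x∈Nᵢ , y∈Nᵢ =
    ⊥-elim (∉⊥ (subst (i ∈_) disjoint
                      (x∈p∩q⁺ (∈-transpose⁺ N x∈Nᵢ , ∈-transpose⁺ N y∈Nᵢ))))

represents⇒cover : ∀ {n k} {E : FinGraph n} {label : Fin n → Subset k} →
                   Represents (toGraph E) label → CompleteCover E k
represents⇒cover {E = E} {label} rep = transpose label , independent , covers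
  where
  independent : ∀ i → IsIndependent E (transpose label i)
  independent i x y x∈Nᵢ y∈Nᵢ e =
    ∉⊥ (subst (i ∈_) (proj₂ (Equivalence.to (rep x y) e))
                     (x∈p∩q⁺ (∈-transpose⁻ label x∈Nᵢ , ∈-transpose⁻ label y∈Nᵢ)))
  covers : ∀ x y → x ≢ y → ¬ E x y → ∃ λ i → x ∈ transpose label i × y ∈ transpose label i
  covers x y x≢y ¬e with nonempty? (label x ∩ label y)
  ... | yes (i , i∈∩) =
    let (i∈x , i∈y) = x∈p∩q⁻ _ _ i∈∩ in i , ∈-transpose⁺ label i∈x , ∈-transpose⁺ label i∈y
  ... | no empty      = ⊥-elim (¬e (Equivalence.from (rep x y) (x≢y , Empty-unique empty)))

pad-cover : ∀ {n} {E : FinGraph n} {m k} → m ≤′ k → CompleteCover E m → CompleteCover E k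
pad-cover                      ≤′-refl        cover = cover
pad-cover {n} {E} {k = suc k} (≤′-step m≤′k) cover with pad-cover m≤′k cover
... | N , independent , covers = N′ , independent′ , covers′
  where
  N′ : Fin (suc k) → Subset n
  N′ zero    = ∅
  N′ (suc i) = N i
  independent′ : ∀ i → IsIndependent E (N′ i)
  independent′ zero    x _ x∈∅ _ = ⊥-elim (∉⊥ x∈∅)
  independent′ (suc i)           = independent i
  covers′ : ∀ x y → x ≢ y → ¬ E x y → ∃ λ i → x ∈ N′ i × y ∈ N′ i
  covers′ x y x≢y ¬e =
    let (i , x∈Nᵢ , y∈Nᵢ) = covers x y x≢y ¬e in suc i , x∈Nᵢ , y∈Nᵢ

blob-adjacent⇔ : ∀ {k} (s : Subset k → ℕ) M {u w : V (blob s M)} →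
                 E (blob s M) u w ⇔ (M ≡ ∅ × u ≢ w)
blob-adjacent⇔ s M {u} {w} = mk⇔ (to M u w) (from M u w)
  where
  to : ∀ M (u w : V (blob s M)) → E (blob s M) u w → M ≡ ∅ × u ≢ w
  to M u w e with isEmptySet M in eq
  ... | true  = Equivalence.to (isEmptySet⇔≡∅ M) eq , e
  ... | false = ⊥-elim e
  from : ∀ M (u w : V (blob s M)) → M ≡ ∅ × u ≢ w → E (blob s M) u w
  from M u w (M≡∅ , u≢w) with isEmptySet M | Equivalence.from (isEmptySet⇔≡∅ M) M≡∅
  ... | true | _ = u≢w

blob↔Fin : ∀ {k} (s : Subset k → ℕ) M → Fin (s M) ↔ V (blob s M)
blob↔Fin s M with isEmptySet M
... | true  = ↔-refl
... | false = ↔-refl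

substitute-represents : ∀ {k} (s : Subset k → ℕ) →
                        Represents (Substitute G[ k ] (blob s)) proj₁
substitute-represents {k} s a b = mk⇔ (to a b) (from a b)
  where
  to : ∀ a b → SubstE G[ k ] (blob s) a b → a ≢ b × proj₁ a ∩ proj₁ b ≡ ∅
  to (M , u) (.M , w) (inside e) =
    let (M≡∅ , u≢w) = Equivalence.to (blob-adjacent⇔ s M) e
    in (λ { refl → u≢w refl }) , trans (∩-idem M) M≡∅
  to a b (across (M≢L , disjoint)) = (λ { refl → M≢L refl }) , disjoint
  from : ∀ a b → a ≢ b × proj₁ a ∩ proj₁ b ≡ ∅ → SubstE G[ k ] (blob s) a b
  from (M , u) (L , w) (a≢b , disjoint) with M ≟ˢ L
  ... | no M≢L   = across (M≢L , disjoint)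
  ... | yes refl = inside (Equivalence.from (blob-adjacent⇔ s M)
                             (self-disjoint⇒≡∅ disjoint , λ { refl → a≢b refl }))

module _ {G H : Graph} (f : V G ↔ V H) where
  open Inverse f

  to-≢⇔ : ∀ {x y} → x ≢ y ⇔ to x ≢ to y
  to-≢⇔ {x} {y} = mk⇔ (λ x≢y tx≡ty → x≢y (trans (sym (strictlyInverseʳ x))
                                            (trans (cong from tx≡ty) (strictlyInverseʳ y))))
                       (λ tx≢ty x≡y → tx≢ty (cong to x≡y))

  represents-pullback : ∀ {k} {label : V H → Subset k} →
                        (∀ x y → E G x y ⇔ E H (to x) (to y)) →
                        Represents H label → Represents G (label ∘ to)
  represents-pullback adjacent⇔ rep x y = mk⇔
    (λ e → let (tx≢ty , disjoint) = Equivalence.to (rep (to x) (to y)) (Equivalence.to (adjacent⇔ x y) e)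
           in Equivalence.from to-≢⇔ tx≢ty , disjoint)
    (λ (x≢y , disjoint) → Equivalence.from (adjacent⇔ x y)
      (Equivalence.from (rep (to x) (to y)) (Equivalence.to to-≢⇔ x≢y , disjoint)))

  represents⇒≅ : ∀ {k} {label : V H → Subset k} →
                 Represents G (label ∘ to) → Represents H label → G ≅ H
  represents⇒≅ repG repH = f , λ x y → mk⇔
    (λ e → let (x≢y , disjoint) = Equivalence.to (repG x y) e
           in Equivalence.from (repH (to x) (to y)) (Equivalence.to to-≢⇔ x≢y , disjoint))
    (λ e → let (tx≢ty , disjoint) = Equivalence.to (repH (to x) (to y)) e
           in Equivalence.from (repG x y) (Equivalence.from to-≢⇔ tx≢ty , disjoint))

count : ∀ {n} {P : Fin n → Set} → U.Decidable P → ℕ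
count {zero}  P? = 0
count {suc n} P? with P? zero
... | yes _ = suc (count (P? ∘ suc))
... | no _  = count (P? ∘ suc)

Σ↔Fin-count : ∀ {n} {P : Fin n → Set} (P? : U.Decidable P) → U.Irrelevant P →
              Σ (Fin n) P ↔ Fin (count P?)
Σ↔Fin-count P? irrelevant = mk↔ₛ′ (to P?) (from P?) (to∘from P?) (from∘to P? irrelevant)
  where
  sucΣ : ∀ {n} {P : Fin (suc n) → Set} → Σ (Fin n) (P ∘ suc) → Σ (Fin (suc n)) P
  sucΣ (x , p) = suc x , p
  to : ∀ {n} {P : Fin n → Set} (P? : U.Decidable P) → Σ (Fin n) P → Fin (count P?)
  to {suc n} P? p with P? zero
  to {suc n} P? (zero  , p) | yes _ = zero
  to {suc n} P? (suc x , p) | yes _ = suc (to (P? ∘ suc) (x , p))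
  to {suc n} P? (zero  , p) | no ¬p = ⊥-elim (¬p p)
  to {suc n} P? (suc x , p) | no _  = to (P? ∘ suc) (x , p)
  from : ∀ {n} {P : Fin n → Set} (P? : U.Decidable P) → Fin (count P?) → Σ (Fin n) P
  from {suc n} P? i with P? zero
  from {suc n} P? zero    | yes p = zero , p
  from {suc n} P? (suc i) | yes _ = sucΣ (from (P? ∘ suc) i)
  from {suc n} P? i       | no _  = sucΣ (from (P? ∘ suc) i)
  to∘from : ∀ {n} {P : Fin n → Set} (P? : U.Decidable P) i → to P? (from P? i) ≡ i
  to∘from {suc n} P? i with P? zero
  to∘from {suc n} P? zero    | yes _ = refl
  to∘from {suc n} P? (suc i) | yes _ = cong suc (to∘from (P? ∘ suc) i)
  to∘from {suc n} P? i       | no _  = to∘from (P? ∘ suc) i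
  from∘to : ∀ {n} {P : Fin n → Set} (P? : U.Decidable P) → U.Irrelevant P →
            ∀ p → from P? (to P? p) ≡ p
  from∘to {suc n} P? irr p with P? zero
  from∘to {suc n} P? irr (zero  , p) | yes p′ = cong (zero ,_) (irr p′ p)
  from∘to {suc n} P? irr (suc x , p) | yes _  = cong (sucΣ) (from∘to (P? ∘ suc) irr (x , p))
  from∘to {suc n} P? irr (zero  , p) | no ¬p  = ⊥-elim (¬p p)
  from∘to {suc n} P? irr (suc x , p) | no _   = cong (sucΣ) (from∘to (P? ∘ suc) irr (x , p))

↔-fibres : ∀ {n} {A : Set} (f : Fin n → A) → Fin n ↔ Σ A (λ a → Σ (Fin n) (λ x → f x ≡ a))
↔-fibres f =
  mk↔ₛ′ (λ x → f x , x , refl) (proj₁ ∘ proj₂) (λ { (_ , _ , refl) → refl }) (λ _ → refl)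

module Fibres {n k : ℕ} (label : Fin n → Subset k) where

  size : Subset k → ℕ
  size M = count (λ x → label x ≟ˢ M)

  -- Sends x to (label x , _) definitionally, which is what lemma2 needs.
  ↔-substituted : Fin n ↔ Σ (Subset k) (V ∘ blob size)
  ↔-substituted = ↔-trans (↔-fibres label) (Σ-↔ ↔-refl λ {M} →
    ↔-trans (Σ↔Fin-count (λ x → label x ≟ˢ M) (Decidable⇒UIP.≡-irrelevant _≟ˢ_))
            (blob↔Fin size M))

lemma2 : (k : ℕ) → 1 ≤ k → (n : ℕ) → (E : FinGraph n) → IsSimple E → Decidable E →
    cow≤ E k ⇔ ∃ λ (s : Subset k → ℕ) → toGraph E ≅ Substitute G[ k ] (blob s)
lemma2 k _ n E simple E? = mk⇔ cover⇒substitution substitution⇒cover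
  where
  Substitution : Set
  Substitution = ∃ λ (s : Subset k → ℕ) → toGraph E ≅ Substitute G[ k ] (blob s)
  cover⇒substitution : cow≤ E k → Substitution
  cover⇒substitution (m , m≤k , cover) =
    let cover′ = pad-cover (≤⇒≤′ m≤k) cover
        open Fibres (transpose (proj₁ cover′))
    in size , represents⇒≅ ↔-substituted (cover⇒represents simple E? cover′)
                                          (substitute-represents size)
  substitution⇒cover : Substitution → cow≤ E k
  substitution⇒cover (s , f , adjacent⇔) =
    k , ≤-refl , represents⇒cover (represents-pullback f adjacent⇔ (substitute-represents s))
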